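{- Let $\omega$ be a permutation of $[n]$ and let $X\subset[n]$ be an $\omega$-chamber set. Then $X$ is weakly separated from every member of the collection $\mathcal{C}^0$ consisting of $\emptyset$ together with all sets $I^k_\omega\cap[j..n]$ for $1\le k\le n$, $1\le j\le\omega^{ -1}(k)$.
   Context: $[j..n]=\{j,\dots,n\}$, $I^k_\omega=\{i:\omega(i)\le k\}$. For $A,B\subseteq[n]$ write $A\lessdot B$ if $B-A\neq\emptyset$ and $i<j$ for all $i\in A-B$, $j\in B-A$. Write $A\rhd B$ if both $A-B$ and $B-A$ are nonempty and $B-A$ is a disjoint union $B'\sqcup B''$ of nonempty sets with $b'<a<b''$ for all $b'\in B'$, $a\in A-B$, $b''\in B''$. Sets $A,B$ are weakly separated if $A\lessdot B$, or $B\lessdot A$, or ($A\rhd B$ and $|A|\ge|B|$), or ($B\rhd A$ and $|B|\ge|A|$), or $A=B$. A set $X\subseteq[n]$ is an $\omega$-chamber set if $i\in X$, $j<i$ and $\omega(j)<\omega(i)$ imply $j\in X$. -}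

module Defs where

open import Data.Nat using (ℕ; _≥_)
open import Data.Fin using (Fin; _<_; _≤_; _≤?_)
open import Data.Fin.Subset using (Subset; _∈_; _∉_; _∪_; _∩_; ∁; ⊥; ∣_∣; Nonempty)
open import Data.Fin.Permutation using (Permutation′; _⟨$⟩ʳ_)
open import Data.Vec using (tabulate)
open import Data.Product using (Σ; _×_)
open import Data.Sum using (_⊎_)
open import Relation.Binary.PropositionalEquality using (_≡_)
open import Relation.Nullary.Decidable using (⌊_⌋)

-- Convention: [n] = {1,…,n} is modelled by Fin n = {0,…,n-1} (order-preserving shift by 1).

_─_ : ∀ {n} → Subset n → Subset n → Subset n
A ─ B = A ∩ ∁ B

_⋖_ : ∀ {n} → Subset n → Subset n → Set
_⋖_ {n} A B = Nonempty (B ─ A) ×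
  ((i j : Fin n) → i ∈ (A ─ B) → j ∈ (B ─ A) → i < j)

_▷_ : ∀ {n} → Subset n → Subset n → Set
_▷_ {n} A B = Nonempty (A ─ B) × Nonempty (B ─ A) ×
  Σ (Subset n) λ B′ → Σ (Subset n) λ B″ →
    (B′ ∩ B″ ≡ ⊥) × (B′ ∪ B″ ≡ B ─ A) × Nonempty B′ × Nonempty B″ ×
    ((b′ a b″ : Fin n) → b′ ∈ B′ → a ∈ (A ─ B) → b″ ∈ B″ → (b′ < a) × (a < b″))

WeaklySeparated : ∀ {n} → Subset n → Subset n → Set
WeaklySeparated A B =
  (A ⋖ B) ⊎ (B ⋖ A) ⊎ ((A ▷ B) × ∣ A ∣ ≥ ∣ B ∣) ⊎ ((B ▷ A) × ∣ B ∣ ≥ ∣ A ∣) ⊎ (A ≡ B)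

ChamberSet : ∀ {n} → Permutation′ n → Subset n → Set
ChamberSet {n} ω X = (i j : Fin n) → i ∈ X → j < i → (ω ⟨$⟩ʳ j) < (ω ⟨$⟩ʳ i) → j ∈ X

I[_]_ : ∀ {n} → Permutation′ n → Fin n → Subset n
I[ ω ] k = tabulate λ i → ⌊ (ω ⟨$⟩ʳ i) ≤? k ⌋

interval : ∀ {n} → Fin n → Subset n
interval j = tabulate λ i → ⌊ j ≤? i ⌋

module Submission where

-- Every set Y in the collection C⁰ is "precedence-separated" from a chamber
-- set X: each element of X - Y is smaller than each element of Y - X.  Such a
-- pair is always weakly separated (X ⋖ Y when Y - X ≠ ∅, Y ⋖ X vacuously when
-- only X - Y ≠ ∅, and X = Y otherwise), so the theorem reduces to checking
-- precedence.  For Y = ∅ there is nothing to check.  For Y = I^k_ω ∩ [j..n],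
-- take a ∈ X - Y and b ∈ Y - X and suppose b < a.  Then j ≤ b < a, so a lies
-- in [j..n] and a ∉ Y forces ω(a) > k ≥ ω(b); the chamber property of X at a
-- then puts b into X, a contradiction.

open import Defs
open import Data.Bool.Properties using (T-≡)
open import Data.Fin using (Fin; _≤_; _<_; _≤?_)
open import Data.Fin.Properties using (<-cmp)
open import Data.Fin.Subset using (Subset; _∩_; ∁; ⊥; _∈_; _∉_; _⊆_; Nonempty)
open import Data.Fin.Subset.Properties
  using (⊆-antisym; x∈p∩q⁺; x∈p∩q⁻; x∈∁p⇒x∉p; x∉p⇒x∈∁p; nonempty?; ∉⊥; _∈?_)
open import Data.Fin.Permutation using (Permutation′; _⟨$⟩ˡ_; _⟨$⟩ʳ_)
open import Data.Nat using (ℕ)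
-- Fin's order is ℕ's order on toℕ, so ℕ's order lemmas apply directly.
open import Data.Nat.Properties using (≤-trans; <⇒≤; ≤-<-trans; ≰⇒>)
open import Data.Product using (_×_; _,_; proj₁)
open import Data.Sum using (inj₁; inj₂)
open import Data.Vec using (tabulate)
open import Data.Vec.Properties using ([]=⇒lookup; lookup⇒[]=; lookup∘tabulate)
open import Function.Bundles using (Equivalence)
open import Relation.Binary using (tri<; tri≈; tri>)
open import Relation.Binary.PropositionalEquality using (refl; trans; sym)
open import Relation.Nullary using (yes; no; ¬_; contradiction)
open import Relation.Nullary.Decidable using (⌊_⌋; toWitness; fromWitness)
open import Relation.Unary using (Pred; Decidable)

∈─⁺ : ∀ {n} {A B : Subset n} {x : Fin n} → x ∈ A → x ∉ B → x ∈ A ─ B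
∈─⁺ x∈A x∉B = x∈p∩q⁺ (x∈A , x∉p⇒x∈∁p x∉B)

∈─⁻ : ∀ {n} {A B : Subset n} {x : Fin n} → x ∈ A ─ B → x ∈ A × x ∉ B
∈─⁻ {A = A} {B} x∈A─B with x∈p∩q⁻ A (∁ B) x∈A─B
... | x∈A , x∈∁B = x∈A , x∈∁p⇒x∉p x∈∁B

module _ {n p} {P : Pred (Fin n) p} (P? : Decidable P) where

  ∈-tabulate⁻ : ∀ {i} → i ∈ tabulate (λ x → ⌊ P? x ⌋) → P i
  ∈-tabulate⁻ {i} i∈ = toWitness (Equivalence.from T-≡
    (trans (sym (lookup∘tabulate (λ x → ⌊ P? x ⌋) i)) ([]=⇒lookup i∈)))

  ∈-tabulate⁺ : ∀ {i} → P i → i ∈ tabulate (λ x → ⌊ P? x ⌋)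
  ∈-tabulate⁺ {i} Pi = lookup⇒[]= i _
    (trans (lookup∘tabulate (λ x → ⌊ P? x ⌋) i) (Equivalence.to T-≡ (fromWitness Pi)))

─-empty⇒⊆ : ∀ {n} {X Y : Subset n} → ¬ Nonempty (X ─ Y) → X ⊆ Y
─-empty⇒⊆ {Y = Y} empty {x} x∈X with x ∈? Y
... | yes x∈Y = x∈Y
... | no  x∉Y = contradiction (x , ∈─⁺ x∈X x∉Y) empty

Precedes : ∀ {n} → Subset n → Subset n → Set
Precedes {n} X Y = (a b : Fin n) → a ∈ X ─ Y → b ∈ Y ─ X → a < b

precedes⇒weaklySeparated : ∀ {n} (X Y : Subset n) → Precedes X Y → WeaklySeparated X Y
precedes⇒weaklySeparated X Y prec with nonempty? (Y ─ X) | nonempty? (X ─ Y)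
... | yes Y─X≢∅ | _         = inj₁ (Y─X≢∅ , prec)
... | no  Y─X≡∅ | yes X─Y≢∅ = inj₂ (inj₁ (X─Y≢∅ , λ i _ i∈Y─X _ → contradiction (i , i∈Y─X) Y─X≡∅))
... | no  Y─X≡∅ | no  X─Y≡∅ =
  inj₂ (inj₂ (inj₂ (inj₂ (⊆-antisym (─-empty⇒⊆ X─Y≡∅) (─-empty⇒⊆ Y─X≡∅)))))

precedes-⊥ : ∀ {n} (X : Subset n) → Precedes X ⊥
precedes-⊥ X a b _ b∈⊥─X = contradiction (proj₁ (∈─⁻ b∈⊥─X)) ∉⊥

module _ {n} (ω : Permutation′ n) (k j : Fin n) where

  Y : Subset n
  Y = I[ ω ] k ∩ interval j

  ω-increases-out-of-Y : ∀ {a b} → b ∈ Y → a ∉ Y → b < a → ω ⟨$⟩ʳ b < ω ⟨$⟩ʳ a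
  ω-increases-out-of-Y {a} {b} b∈Y a∉Y b<a with x∈p∩q⁻ (I[ ω ] k) (interval j) b∈Y
  ... | b∈I , b∈J = ≤-<-trans ωb≤k (≰⇒> ωa≰k)
    where
    ωb≤k : ω ⟨$⟩ʳ b ≤ k
    ωb≤k = ∈-tabulate⁻ (λ i → ω ⟨$⟩ʳ i ≤? k) b∈I

    j≤a : j ≤ a
    j≤a = ≤-trans (∈-tabulate⁻ (j ≤?_) b∈J) (<⇒≤ b<a)

    ωa≰k : ¬ (ω ⟨$⟩ʳ a ≤ k)
    ωa≰k ωa≤k = a∉Y (x∈p∩q⁺ (∈-tabulate⁺ (λ i → ω ⟨$⟩ʳ i ≤? k) ωa≤k ,
                             ∈-tabulate⁺ (j ≤?_) j≤a))

  chamber-precedes : (X : Subset n) → ChamberSet ω X → Precedes X Y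
  chamber-precedes X chamber a b a∈X─Y b∈Y─X with ∈─⁻ a∈X─Y | ∈─⁻ b∈Y─X | <-cmp a b
  ... | _ , _     | _ , _     | tri< a<b _ _ = a<b
  ... | a∈X , _   | _ , b∉X   | tri≈ _ refl _ = contradiction a∈X b∉X
  ... | a∈X , a∉Y | b∈Y , b∉X | tri> _ _ b<a =
    contradiction (chamber a b a∈X b<a (ω-increases-out-of-Y b∈Y a∉Y b<a)) b∉X

lemma2p5 : (n : ℕ) (ω : Permutation′ n) (X : Subset n) → ChamberSet ω X →
    WeaklySeparated X ⊥ ×
      ((k j : Fin n) → j ≤ (ω ⟨$⟩ˡ k) → WeaklySeparated X ((I[ ω ] k) ∩ interval j))
lemma2p5 n ω X chamber =
  precedes⇒weaklySeparated X ⊥ (precedes-⊥ X) ,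
  λ k j _ → precedes⇒weaklySeparated X _ (chamber-precedes ω k j X chamber)
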